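{- Let $X$ be a diagram (strict functor) $X : \mathcal{C} \to \mathcal{U}$ over an admissible inverse category $\mathcal{C}$. Then there exists a Reedy fibrant diagram $Y : \mathcal{C} \to \mathcal{U}$ and an equivalence of diagrams $\eta : X \to Y$.
   Context: We work internally in a two-level type theory: there are fibrant types (with fibrant universe $\mathcal{U}$ and fibrant equality $=$) and strict types (with strict universe $\mathcal{U}^{\mathrm{s}}$ and strict equality $=_{\mathrm{s}}$, satisfying UIP and function extensionality), every fibrant type coercing to a strict type. Categories are strict categories (category laws hold up to strict equality). For a category $\mathcal{C}$ and object $x$, the reduced coslice $x /\!\!/ \mathcal{C}$ is the full subcategory of the coslice $x/\mathcal{C}$ on the non-identity arrows out of $x$; it comes with a forgetful functor $\mathsf{forget} : x /\!\!/ \mathcal{C} \to \mathcal{C}$. A category $\mathcal{C}$ is an inverse category if there is a functor $\varphi : \mathcal{C} \to (\mathbb{N}^{\mathrm{s}})^{\mathrm{op}}$ (where $(\mathbb{N}^{\mathrm{s}})^{\mathrm{op}}(n,m) :\equiv n >^{\mathrm{s}} m$) which creates identities: if $f : \mathcal{C}(x,y)$ and $\varphi_x =_{\mathrm{s}} \varphi_y$, then $x =_{\mathrm{s}} y$ and $f$ is (transported to) the identity. For a functor $X : \mathcal{C} \to \mathcal{U}$ and object $z$, the matching object $M^X_z$ is the (strict, not necessarily fibrant) limit of $x /\!\!/ \mathcal{C} \xrightarrow{\mathsf{forget}} \mathcal{C} \xrightarrow{X} \mathcal{U} \subset \mathcal{U}^{\mathrm{s}}$ (with $z$ in place of $x$).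 A map $p : E \to B$ is a fibration if there is $F : B \to \mathcal{U}$ with each fibre of $p$ over $b$ strictly isomorphic to $F(b)$. $X$ is Reedy fibrant if for all $z$ the canonical map $X_z \to M^X_z$ is a fibration. A functor $X : \mathcal{C} \to \mathcal{U}$ has a fibrant limit if its limit in $\mathcal{U}^{\mathrm{s}}$ is strictly isomorphic to a fibrant type. An inverse category $\mathcal{C}$ is admissible if, for every object $x$, every Reedy fibrant diagram over the reduced coslice $x /\!\!/ \mathcal{C}$ has a fibrant limit. A natural transformation $f : X \to Y$ between diagrams over $\mathcal{C}$ is an equivalence if each component $f_n : X_n \to Y_n$ is an equivalence of types. -}

module Defs where

open import Level using (0ℓ)
open import Data.Nat using (ℕ; _≤_)
open import Data.Product using (Σ; _×_; _,_; proj₁; proj₂)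
open import Data.Unit using (⊤)
open import Relation.Nullary using (¬_)
open import Relation.Binary.PropositionalEquality
  using (_≡_; refl; sym; trans; cong; subst)

-- The strict layer: Agda's Set with _≡_ (UIP holds since K is on).
-- Strict isomorphism of strict types.

record _≅ₛ_ (A B : Set) : Set where
  field
    to      : A → B
    from    : B → A
    from∘to : ∀ a → from (to a) ≡ a
    to∘from : ∀ b → to (from b) ≡ b

-- The fibrant layer: a Tarski-style fibrant universe 𝒰 of codes with
-- coercion El into strict types, closed under the fibrant type formers
-- of two-level type theory (1, Π, Σ and the fibrant identity type with
-- its eliminator J, which only eliminates into fibrant families and
-- computes strictly).

record FibrantUniverse : Set₁ where
  field
    U  : Set
    El : U → Set

    𝟙̂     : U
    𝟙-iso : El 𝟙̂ ≅ₛ ⊤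

    Π̂     : (A : U) → (El A → U) → U
    Π-iso : ∀ {A B} → El (Π̂ A B) ≅ₛ ((a : El A) → El (B a))

    Σ̂     : (A : U) → (El A → U) → U
    Σ-iso : ∀ {A B} → El (Σ̂ A B) ≅ₛ Σ (El A) (λ a → El (B a))

    Id̂    : (A : U) → El A → El A → U
    refl̂  : ∀ {A} (a : El A) → El (Id̂ A a a)
    J     : ∀ {A} {a : El A} (P : (b : El A) → El (Id̂ A a b) → U)
            → El (P a (refl̂ a)) → (b : El A) (p : El (Id̂ A a b)) → El (P b p)
    J-β   : ∀ {A} {a : El A} (P : (b : El A) → El (Id̂ A a b) → U)
            (d : El (P a (refl̂ a))) → J P d a (refl̂ a) ≡ d

record Category : Set₁ where
  infixr 9 _∘_
  field
    Obj  : Set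
    Hom  : Obj → Obj → Set
    id   : ∀ {x} → Hom x x
    _∘_  : ∀ {x y z} → Hom y z → Hom x y → Hom x z
    idˡ  : ∀ {x y} (f : Hom x y) → id ∘ f ≡ f
    idʳ  : ∀ {x y} (f : Hom x y) → f ∘ id ≡ f
    assoc : ∀ {w x y z} (h : Hom y z) (g : Hom x y) (f : Hom w x)
            → (h ∘ g) ∘ f ≡ h ∘ (g ∘ f)

record Functor (D C : Category) : Set where
  private
    module D = Category D
    module C = Category C
  field
    F₀    : D.Obj → C.Obj
    F₁    : ∀ {x y} → D.Hom x y → C.Hom (F₀ x) (F₀ y)
    F-id  : ∀ {x} → F₁ (D.id {x}) ≡ C.id
    F-∘   : ∀ {x y z} (g : D.Hom y z) (f : D.Hom x y)
            → F₁ (g D.∘ f) ≡ F₁ g C.∘ F₁ f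

module _ (C : Category) where
  open Category C

  IsIdentity : ∀ {x y} → Hom x y → Set
  IsIdentity {x} {y} f = Σ (x ≡ y) (λ p → subst (Hom x) p (id {x}) ≡ f)

  NonIdentity : ∀ {x y} → Hom x y → Set
  NonIdentity f = ¬ IsIdentity f

private
  uip : {A : Set} {a b : A} (p q : a ≡ b) → p ≡ q
  uip refl refl = refl

  pair≡ : {A : Set} {B : A → Set} {a a' : A} {b : B a} {b' : B a'}
          (p : a ≡ a') → subst B p b ≡ b' → (a , b) ≡ (a' , b')
  pair≡ refl refl = refl

-- The reduced coslice x // C: full subcategory of x / C on the
-- non-identity arrows out of x.
_//_ : (C : Category) → Category.Obj C → Category
C // x = record
  { Obj   = Σ Obj (λ y → Σ (Hom x y) (λ f → NonIdentity C f))
  ; Hom   = λ { (y , f , _) (y' , f' , _) → Σ (Hom y y') (λ g → g ∘ f ≡ f') }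
  ; id    = λ { {y , f , _} → id , idˡ f }
  ; _∘_   = λ { {_ , f , _} (h , q) (g , p) →
                  h ∘ g , trans (assoc h g f) (trans (cong (h ∘_) p) q) }
  ; idˡ   = λ { (g , p) → pair≡ (idˡ g) (uip _ _) }
  ; idʳ   = λ { (g , p) → pair≡ (idʳ g) (uip _ _) }
  ; assoc = λ { (h , _) (g , _) (f , _) → pair≡ (assoc h g f) (uip _ _) }
  }
  where open Category C

forget : (C : Category) (x : Category.Obj C) → Functor (C // x) C
forget C x = record
  { F₀   = λ { (y , _ , _) → y }
  ; F₁   = λ { (g , _) → g }
  ; F-id = refl
  ; F-∘  = λ _ _ → refl
  }

-- Inverse categories: a functor φ : C → (ℕˢ)ᵒᵖ creating identities.
-- (Functoriality is automatic since the hom-sets of (ℕˢ)ᵒᵖ are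
-- propositions.)

record IsInverse (C : Category) : Set where
  open Category C
  field
    φ₀      : Obj → ℕ
    φ₁      : ∀ {x y} → Hom x y → φ₀ y ≤ φ₀ x
    creates : ∀ {x y} (f : Hom x y) → φ₀ x ≡ φ₀ y → IsIdentity C f

record SDiagram (C : Category) : Set₁ where
  open Category C
  field
    obj    : Obj → Set
    map    : ∀ {x y} → Hom x y → obj x → obj y
    map-id : ∀ {x} (a : obj x) → map (id {x}) a ≡ a
    map-∘  : ∀ {x y z} (g : Hom y z) (f : Hom x y) (a : obj x)
             → map (g ∘ f) a ≡ map g (map f a)

Lim : {C : Category} → SDiagram C → Set
Lim {C} X = Σ ((x : Obj) → obj x)
              (λ c → ∀ {x y} (f : Hom x y) → map f (c x) ≡ c y)
  where open Category C
        open SDiagram X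

_∘F_ : {D C : Category} → SDiagram C → Functor D C → SDiagram D
_∘F_ {D} {C} X F = record
  { obj    = λ d → obj (F₀ d)
  ; map    = λ f → map (F₁ f)
  ; map-id = λ a → trans (cong (λ g → map g a) F-id) (map-id a)
  ; map-∘  = λ g f a → trans (cong (λ h → map h a) (F-∘ g f)) (map-∘ _ _ a)
  }
  where open SDiagram X
        open Functor F

module _ (𝓕 : FibrantUniverse) where
  open FibrantUniverse 𝓕

  record Diagram (C : Category) : Set where
    open Category C
    field
      obj    : Obj → U
      map    : ∀ {x y} → Hom x y → El (obj x) → El (obj y)
      map-id : ∀ {x} (a : El (obj x)) → map (id {x}) a ≡ a
      map-∘  : ∀ {x y z} (g : Hom y z) (f : Hom x y) (a : El (obj x))
               → map (g ∘ f) a ≡ map g (map f a)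

  toStrict : {C : Category} → Diagram C → SDiagram C
  toStrict X = record
    { obj = λ x → El (obj x) ; map = map ; map-id = map-id ; map-∘ = map-∘ }
    where open Diagram X

  Matching : {C : Category} → Diagram C → Category.Obj C → Set
  Matching {C} X z = Lim (toStrict X ∘F forget C z)

  matchingMap : {C : Category} (X : Diagram C) (z : Category.Obj C)
                → El (Diagram.obj X z) → Matching X z
  matchingMap {C} X z a =
      (λ { (w , f , _) → map f a })
    , (λ { {_ , f , _} {_ , f' , _} (g , p) →
             trans (sym (map-∘ g f a)) (cong (λ h → map h a) p) })
    where open Diagram X

  Fibre : {E B : Set} → (E → B) → B → Set
  Fibre {E} p b = Σ E (λ e → p e ≡ b)

  IsFibration : {E B : Set} → (E → B) → Set
  IsFibration {E} {B} p =
    Σ (B → U) (λ F → (b : B) → Fibre p b ≅ₛ El (F b))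

  ReedyFibrant : {C : Category} → Diagram C → Set
  ReedyFibrant {C} X = (z : Category.Obj C) → IsFibration (matchingMap X z)

  HasFibrantLimit : {C : Category} → Diagram C → Set
  HasFibrantLimit X = Σ U (λ A → Lim (toStrict X) ≅ₛ El A)

  Admissible : (C : Category) → IsInverse C → Set
  Admissible C _ = (x : Category.Obj C) (D : Diagram (C // x))
                   → ReedyFibrant D → HasFibrantLimit D

  IsEquiv : {A B : U} → (El A → El B) → Set
  IsEquiv {A} {B} f =
      Σ (El B → El A) (λ g → (a : El A) → El (Id̂ A (g (f a)) a))
    × Σ (El B → El A) (λ h → (b : El B) → El (Id̂ B (f (h b)) b))

  record NatTrans {C : Category} (X Y : Diagram C) : Set where
    open Category C
    private
      module X = Diagram X
      module Y = Diagram Y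
    field
      η       : (x : Obj) → El (X.obj x) → El (Y.obj x)
      natural : ∀ {x y} (f : Hom x y) (a : El (X.obj x))
                → η y (X.map f a) ≡ Y.map f (η x a)

  IsEquivalence : {C : Category} {X Y : Diagram C} → NatTrans X Y → Set
  IsEquivalence {C} η = (x : Category.Obj C) → IsEquiv (NatTrans.η η x)

module Submission where

-- Given X : C → 𝒰 we build, by recursion on the level n, a sequence of
-- replacements (Y, η : X → Y) such that at stage n the transformation η is
-- an equivalence everywhere and the matching maps of Y at all objects of
-- level < n are fibrations.  Passing from stage n to n + 1 changes Y only
-- at the objects w of level n: the restriction of Y to w // C only sees
-- levels < n, so it is Reedy fibrant and by admissibility the matching
-- object M_w is fibrant; the matching map Y_w → M_w then factors as an
-- equivalence followed by a fibration (the path-space factorisation) and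
-- Y_w is replaced by the middle object.  Consecutive stages agree below n
-- up to casts of codes, so the final diagram takes at w the value of stage
-- φ w + 1, and inherits both properties from it.

open import Defs
open import Level using (0ℓ)
open import Function using (_∘′_)
open import Data.Product using (Σ; _×_; _,_; proj₁; proj₂)
open import Data.Product.Properties using (Σ-≡,≡→≡; Σ-≡,≡←≡)
open import Data.Empty using (⊥-elim)
open import Data.Nat using (ℕ; zero; suc; _≤_; _<_; s≤s; _≤′_; ≤′-reflexive; ≤′-step)
open import Data.Nat.Properties
  using (_≟_; <-irrefl; ≤-<-trans; <-≤-trans; <⇒≤; <⇒≢; ≤∧≢⇒<; ≤-antisym; ≤-reflexive; n<1+n;
         ≤⇒≤′; ≤′⇒≤; m<1+n⇒m<n∨m≡n)
open import Data.Sum using (inj₁; inj₂)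
open import Relation.Nullary using (¬_; Dec; yes; no)
open import Relation.Binary.PropositionalEquality hiding (J)
open import Axiom.Extensionality.Propositional using (Extensionality; implicit-extensionality)
open import Axiom.UniquenessOfIdentityProofs.WithK using (uip)

open _≅ₛ_

Σ-≡-proof-irrelevant : {A B : Set} {h : A → B} {y : B} {a a' : A} {p : h a ≡ y} {p' : h a' ≡ y}
                       → a ≡ a' → _≡_ {A = Σ A (λ x → h x ≡ y)} (a , p) (a' , p')
Σ-≡-proof-irrelevant {p = p} {p'} refl = cong (_ ,_) (uip p p')

≅-refl : {A : Set} → A ≅ₛ A
≅-refl = record { to = λ a → a ; from = λ a → a ; from∘to = λ _ → refl ; to∘from = λ _ → refl }

≅-sym : {A B : Set} → A ≅ₛ B → B ≅ₛ A
≅-sym i = record { to = from i ; from = to i ; from∘to = to∘from i ; to∘from = from∘to i }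

≅-trans : {A B D : Set} → A ≅ₛ B → B ≅ₛ D → A ≅ₛ D
≅-trans i j = record
  { to      = to j ∘′ to i
  ; from    = from i ∘′ from j
  ; from∘to = λ a → trans (cong (from i) (from∘to j (to i a))) (from∘to i a)
  ; to∘from = λ d → trans (cong (to j) (to∘from i (from j d))) (to∘from j d)
  }

module Extensional (ext : Extensionality 0ℓ 0ℓ) where

  ¬-irrelevant : {P : Set} (a b : ¬ P) → a ≡ b
  ¬-irrelevant a b = ext (λ x → ⊥-elim (a x))

  Lim-≡ : {C : Category} {S : SDiagram C} {l l' : Lim S}
          → (∀ x → proj₁ l x ≡ proj₁ l' x) → l ≡ l'
  Lim-≡ {l = c , n} {c' , n'} same with ext same
  ... | refl = cong (c ,_) (implicit-extensionality ext (implicit-extensionality ext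
                 (ext (λ f → uip (n f) (n' f)))))

module FibrantFacts (𝓕 : FibrantUniverse) where
  open FibrantUniverse 𝓕

  cast : {A B : U} → A ≡ B → El A → El B
  cast = subst El

  cast-coherent : {A B D : U} (e₁ : A ≡ B) (e₂ : B ≡ D) (e₃ : A ≡ D) (x : El A)
                  → cast e₂ (cast e₁ x) ≡ cast e₃ x
  cast-coherent refl refl e₃ x = cong (λ e → cast e x) (uip refl e₃)

  cast-iso : {A B : U} → A ≡ B → El A ≅ₛ El B
  cast-iso e = record
    { to = cast e ; from = cast (sym e)
    ; from∘to = cast-coherent e (sym e) refl
    ; to∘from = cast-coherent (sym e) e refl }

  fibration-transfer : {E B E' B' : Set} (p : E → B) (p' : E' → B') (α : E ≅ₛ E') (β : B ≅ₛ B')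
    → (∀ e → p' (to α e) ≡ to β (p e)) → IsFibration 𝓕 p → IsFibration 𝓕 p'
  fibration-transfer {E} {B} {E'} {B'} p p' α β square (F , fibre≅F) =
    (λ b' → F (from β b')) , λ b' → ≅-trans (fibre-iso b') (fibre≅F (from β b'))
    where
    over : (b' : B') (e' : E') → p' e' ≡ b' → p (from α e') ≡ from β b'
    over b' e' q = begin
      p (from α e')                  ≡⟨ sym (from∘to β _) ⟩
      from β (to β (p (from α e')))  ≡⟨ cong (from β) (sym (square (from α e'))) ⟩
      from β (p' (to α (from α e'))) ≡⟨ cong (from β ∘′ p') (to∘from α e') ⟩
      from β (p' e')                 ≡⟨ cong (from β) q ⟩
      from β b'                      ∎
      where open ≡-Reasoning

    over' : (b' : B') (e : E) → p e ≡ from β b' → p' (to α e) ≡ b'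
    over' b' e q = trans (square e) (trans (cong (to β) q) (to∘from β b'))

    fibre-iso : (b' : B') → Fibre 𝓕 p' b' ≅ₛ Fibre 𝓕 p (from β b')
    fibre-iso b' = record
      { to      = λ { (e' , q) → from α e' , over b' e' q }
      ; from    = λ { (e , q) → to α e , over' b' e q }
      ; from∘to = λ { (e' , q) → Σ-≡-proof-irrelevant (to∘from α e') }
      ; to∘from = λ { (e , q) → Σ-≡-proof-irrelevant (from∘to α e) }
      }

  Id-of-≡ : {A : U} {a b : El A} → a ≡ b → El (Id̂ A a b)
  Id-of-≡ {A} {a} refl = refl̂ a

  ap̂ : {A B : U} (f : El A → El B) {a a' : El A} → El (Id̂ A a a') → El (Id̂ B (f a) (f a'))
  ap̂ {A} {B} f {a} {a'} = J (λ b _ → Id̂ B (f a) (f b)) (refl̂ (f a)) a'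

  _∙̂_ : {A : U} {a b c : El A} → El (Id̂ A a b) → El (Id̂ A b c) → El (Id̂ A a c)
  _∙̂_ {A} {a} {b} {c} p q = J (λ d _ → Id̂ A a d) p c q

  equiv-id : {A : U} → IsEquiv 𝓕 {A} {A} (λ a → a)
  equiv-id = ((λ a → a) , refl̂) , ((λ a → a) , refl̂)

  equiv-∘ : {A B D : U} {g : El B → El D} {f : El A → El B}
            → IsEquiv 𝓕 {B} {D} g → IsEquiv 𝓕 {A} {B} f → IsEquiv 𝓕 {A} {D} (g ∘′ f)
  equiv-∘ {g = g} {f} ((g⁻ , g⁻g) , (g⁺ , gg⁺)) ((f⁻ , f⁻f) , (f⁺ , ff⁺)) =
      (f⁻ ∘′ g⁻ , λ a → ap̂ f⁻ (g⁻g (f a)) ∙̂ f⁻f a)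
    , (f⁺ ∘′ g⁺ , λ d → ap̂ g (ff⁺ (g⁺ d)) ∙̂ gg⁺ d)

  -- The path-space factorisation of a map t : B → A of fibrant types:
  -- t = proj ∘ inc with inc an equivalence onto Σ (m : A) hfib(m), and
  -- proj a fibration whose fibre over m is the homotopy fibre hfib(m).
  module PathFactorisation {A B : U} (t : El B → El A) where
    hfib : El A → U
    hfib m = Σ̂ B (λ b → Id̂ A (t b) m)

    Mid : U
    Mid = Σ̂ A hfib

    private
      ΣMid : El Mid ≅ₛ Σ (El A) (λ m → El (hfib m))
      ΣMid = Σ-iso

      Σhfib : (m : El A) → El (hfib m) ≅ₛ Σ (El B) (λ b → El (Id̂ A (t b) m))
      Σhfib m = Σ-iso

    point : (m : El A) (b : El B) → El (Id̂ A (t b) m) → El Mid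
    point m b p = from ΣMid (m , from (Σhfib m) (b , p))

    inc : El B → El Mid
    inc b = point (t b) b (refl̂ (t b))

    proj : El Mid → El A
    proj x = proj₁ (to ΣMid x)

    retract : El Mid → El B
    retract x = proj₁ (to (Σhfib (proj x)) (proj₂ (to ΣMid x)))

    proj-inc : ∀ b → proj (inc b) ≡ t b
    proj-inc b = cong proj₁ (to∘from ΣMid _)

    retract-point : ∀ m b p → retract (point m b p) ≡ b
    retract-point m b p =
      trans (cong (λ u → proj₁ (to (Σhfib (proj₁ u)) (proj₂ u))) (to∘from ΣMid _))
            (cong proj₁ (to∘from (Σhfib m) (b , p)))

    point-components : ∀ x → let m = proj x ; bp = to (Σhfib m) (proj₂ (to ΣMid x))
                             in point m (proj₁ bp) (proj₂ bp) ≡ x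
    point-components x =
      trans (cong (λ y → from ΣMid (proj x , y)) (from∘to (Σhfib _) _)) (from∘to ΣMid x)

    inc-point : ∀ m b (p : El (Id̂ A (t b) m)) → El (Id̂ Mid (inc b) (point m b p))
    inc-point m b p = J (λ m' p' → Id̂ Mid (inc b) (point m' b p')) (refl̂ (inc b)) m p

    inc-equiv : IsEquiv 𝓕 {B} {Mid} inc
    inc-equiv = (retract , λ b → Id-of-≡ (retract-point (t b) b (refl̂ (t b))))
              , (retract , inc-retract)
      where
      inc-retract : ∀ x → El (Id̂ Mid (inc (retract x)) x)
      inc-retract x = subst (λ y → El (Id̂ Mid (inc (retract x)) y)) (point-components x)
                            (inc-point _ _ _)

    proj-fibration : IsFibration 𝓕 proj
    proj-fibration = hfib , fibre≅hfib
      where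
      fibre≅hfib : (m : El A) → Fibre 𝓕 proj m ≅ₛ El (hfib m)
      fibre≅hfib m = record
        { to      = λ { (x , e) → subst (El ∘′ hfib) e (proj₂ (to ΣMid x)) }
        ; from    = λ y → from ΣMid (m , y) , proj₁ (Σ-≡,≡←≡ (to∘from ΣMid (m , y)))
        ; from∘to = λ { (x , e) → Σ-≡-proof-irrelevant
                         (trans (cong (from ΣMid) (sym (Σ-≡,≡→≡ (e , refl)))) (from∘to ΣMid x)) }
        ; to∘from = λ y → proj₂ (Σ-≡,≡←≡ (to∘from ΣMid (m , y)))
        }

  record Factorisation {B : U} {S : Set} (t : El B → S) : Set where
    field
      Mid            : U
      inc            : El B → El Mid
      inc-equiv      : IsEquiv 𝓕 {B} {Mid} inc
      proj           : El Mid → S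
      proj-fibration : IsFibration 𝓕 proj
      proj-inc       : ∀ b → proj (inc b) ≡ t b

  factorise : {A B : U} {S : Set} → S ≅ₛ El A → (t : El B → S) → Factorisation t
  factorise {A} {B} i t = record
    { Mid            = P.Mid
    ; inc            = P.inc
    ; inc-equiv      = P.inc-equiv
    ; proj           = from i ∘′ P.proj
    ; proj-fibration = fibration-transfer P.proj (from i ∘′ P.proj) ≅-refl (≅-sym i)
                         (λ _ → refl) P.proj-fibration
    ; proj-inc       = λ b → trans (cong (from i) (P.proj-inc b)) (from∘to i (t b))
    }
    where module P = PathFactorisation {A} {B} (to i ∘′ t)

module InverseCategory (𝓕 : FibrantUniverse) (ext : Extensionality 0ℓ 0ℓ)
                       (C : Category) (inv : IsInverse C) where
  open FibrantUniverse 𝓕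
  open Category C
  open IsInverse inv
  open Extensional ext
  open FibrantFacts 𝓕

  nonIdentity-of-≢ : ∀ {x y} (f : Hom x y) → φ₀ x ≢ φ₀ y → NonIdentity C f
  nonIdentity-of-≢ f ne (refl , _) = ne refl

  level-drops : ∀ {x y} (f : Hom x y) → NonIdentity C f → φ₀ y < φ₀ x
  level-drops f nid = ≤∧≢⇒< (φ₁ f) (λ e → nid (creates f (sym e)))

  Matching-≡ : {D : Category} (Y : Diagram 𝓕 D) (z : Category.Obj D) {l l' : Matching 𝓕 Y z}
               → (∀ o → proj₁ l o ≡ proj₁ l' o) → l ≡ l'
  Matching-≡ {D} Y z = Lim-≡ {S = toStrict 𝓕 Y ∘F forget D z}

  restrict : Diagram 𝓕 C → (z : Obj) → Diagram 𝓕 (C // z)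
  restrict Y z = record
    { obj    = λ o → obj (proj₁ o)
    ; map    = λ g → map (proj₁ g)
    ; map-id = map-id
    ; map-∘  = λ g f → map-∘ (proj₁ g) (proj₁ f) }
    where open Diagram Y

  -- For o = (f : z → w) in z // C, the reduced coslice o // (z // C) is
  -- isomorphic to w // C, compatibly with the restricted diagrams; hence
  -- the matching objects of restrict Y z at o are those of Y at w.
  module CosliceOfCoslice (Y : Diagram 𝓕 C) (z : Obj) {w : Obj} (f : Hom z w)
                          (nid : NonIdentity C f) where
    private module Y = Diagram Y

    o : Category.Obj (C // z)
    o = w , f , nid

    Obj² : Set
    Obj² = Category.Obj ((C // z) // o)

    -- An arrow of z // C out of o is an identity exactly when its underlying
    -- arrow of C is; so down and up below keep arrows non-identities.
    identity-down : ∀ {v f' nid'} {g : Hom w v} {p : g ∘ f ≡ f'}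
                    → IsIdentity (C // z) {o} {v , f' , nid'} (g , p) → IsIdentity C g
    identity-down (refl , e) = refl , cong proj₁ e

    identity-up : ∀ {v f' nid'} {g : Hom w v} {p : g ∘ f ≡ f'}
                  → IsIdentity C g → IsIdentity (C // z) {o} {v , f' , nid'} (g , p)
    identity-up {nid' = nid'} {p = p} (refl , refl) = go (trans (sym (idˡ f)) p) nid' p
      where
      go : ∀ {f'} (e : f ≡ f') (nid' : NonIdentity C f') (p : id ∘ f ≡ f')
           → IsIdentity (C // z) {o} {w , f' , nid'} (id , p)
      go refl nid' p with ¬-irrelevant nid nid'
      ... | refl = refl , Σ-≡-proof-irrelevant refl

    -- g ∘ f lowers the level strictly, since f does.
    composite-nonIdentity : ∀ {v} (g : Hom w v) → NonIdentity C (g ∘ f)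
    composite-nonIdentity g =
      nonIdentity-of-≢ (g ∘ f) (λ e → <⇒≢ (≤-<-trans (φ₁ g) (level-drops f nid)) (sym e))

    down : Obj² → Category.Obj (C // w)
    down ((v , _ , _) , (g , _) , nid'') = v , g , λ I → nid'' (identity-up I)

    up : Category.Obj (C // w) → Obj²
    up (v , g , nidg) = (v , g ∘ f , composite-nonIdentity g) , (g , refl) , (λ I → nidg (identity-down I))

    up-down : (d : (O : Obj²) → El (Y.obj (proj₁ (proj₁ O)))) (O : Obj²) → d (up (down O)) ≡ d O
    up-down d ((v , _ , n₁) , (g , refl) , n₂) with ¬-irrelevant (composite-nonIdentity g) n₁
    ... | refl = cong (λ n → d ((v , g ∘ f , n₁) , (g , refl) , n)) (¬-irrelevant _ _)

    matching-iso : Matching 𝓕 Y w ≅ₛ Matching 𝓕 (restrict Y z) o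
    matching-iso = record
      { to      = λ { (c , nat) → (λ O → c (down O))
                                 , λ h → nat (proj₁ (proj₁ h) , cong proj₁ (proj₂ h)) }
      ; from    = λ { (d , nat) → (λ O → d (up O))
                                 , λ { {_ , g₁ , _} (k , q) →
                                         nat ( (k , trans (sym (assoc k g₁ f)) (cong (_∘ f) q))
                                             , Σ-≡-proof-irrelevant q) } }
      ; from∘to = λ { (c , _) → Matching-≡ Y w λ { (v , g , _) → cong (λ n → c (v , g , n)) (¬-irrelevant _ _) } }
      ; to∘from = λ { (d , _) → Matching-≡ (restrict Y z) o (up-down d) }
      }

    matching-iso-commutes : ∀ a → matchingMap 𝓕 (restrict Y z) o a ≡ to matching-iso (matchingMap 𝓕 Y w a)
    matching-iso-commutes a = Matching-≡ (restrict Y z) o (λ _ → refl)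

  restrict-reedy : (Y : Diagram 𝓕 C) (z : Obj)
                   → (∀ w → φ₀ w < φ₀ z → IsFibration 𝓕 (matchingMap 𝓕 Y w))
                   → ReedyFibrant 𝓕 (restrict Y z)
  restrict-reedy Y z fib-below (w , f , nid) =
    fibration-transfer (matchingMap 𝓕 Y w) (matchingMap 𝓕 (restrict Y z) (w , f , nid))
      ≅-refl matching-iso matching-iso-commutes (fib-below w (level-drops f nid))
    where open CosliceOfCoslice Y z f nid

module Replacements (𝓕 : FibrantUniverse) (ext : Extensionality 0ℓ 0ℓ)
                    (C : Category) (inv : IsInverse C) (X : Diagram 𝓕 C) where
  open FibrantUniverse 𝓕
  open Category C
  open IsInverse inv
  open FibrantFacts 𝓕
  open InverseCategory 𝓕 ext C inv
  private module X = Diagram X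

  record Replacement : Set where
    field
      Y : Diagram 𝓕 C
      η : NatTrans 𝓕 X Y

  module _ (R : Replacement) where
    obj : Obj → U
    obj = Diagram.obj (Replacement.Y R)

    map : ∀ {w v} → Hom w v → El (obj w) → El (obj v)
    map = Diagram.map (Replacement.Y R)

    η : (w : Obj) → El (X.obj w) → El (obj w)
    η = NatTrans.η (Replacement.η R)

    natural : ∀ {w v} (f : Hom w v) a → η v (X.map f a) ≡ map f (η w a)
    natural = NatTrans.natural (Replacement.η R)

  record Agree (R R' : Replacement) (k : ℕ) : Set where
    field
      obj-≡ : ∀ w → φ₀ w < k → obj R w ≡ obj R' w
      map-≡ : ∀ {w v} (f : Hom w v) (pw : φ₀ w < k) (pv : φ₀ v < k) (a : El (obj R w))
              → cast (obj-≡ v pv) (map R f a) ≡ map R' f (cast (obj-≡ w pw) a)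
      η-≡   : ∀ w (p : φ₀ w < k) a → cast (obj-≡ w p) (η R w a) ≡ η R' w a

  agree-refl : ∀ {R k} → Agree R R k
  agree-refl = record { obj-≡ = λ _ _ → refl ; map-≡ = λ _ _ _ _ → refl ; η-≡ = λ _ _ _ → refl }

  agree-trans : ∀ {R₁ R₂ R₃ k} → Agree R₁ R₂ k → Agree R₂ R₃ k → Agree R₁ R₃ k
  agree-trans {R₁} {R₂} {R₃} A B = record
    { obj-≡ = λ w p → trans (A.obj-≡ w p) (B.obj-≡ w p)
    ; map-≡ = λ {w} {v} f pw pv a → begin
        cast (trans (A.obj-≡ v pv) (B.obj-≡ v pv)) (map R₁ f a)
          ≡⟨ sym (cast-coherent (A.obj-≡ v pv) (B.obj-≡ v pv) _ _) ⟩
        cast (B.obj-≡ v pv) (cast (A.obj-≡ v pv) (map R₁ f a))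
          ≡⟨ cong (cast (B.obj-≡ v pv)) (A.map-≡ f pw pv a) ⟩
        cast (B.obj-≡ v pv) (map R₂ f (cast (A.obj-≡ w pw) a))
          ≡⟨ B.map-≡ f pw pv _ ⟩
        map R₃ f (cast (B.obj-≡ w pw) (cast (A.obj-≡ w pw) a))
          ≡⟨ cong (map R₃ f) (cast-coherent (A.obj-≡ w pw) (B.obj-≡ w pw) _ a) ⟩
        map R₃ f (cast (trans (A.obj-≡ w pw) (B.obj-≡ w pw)) a) ∎
    ; η-≡ = λ w p a → trans (sym (cast-coherent (A.obj-≡ w p) (B.obj-≡ w p) _ _))
                        (trans (cong (cast (B.obj-≡ w p)) (A.η-≡ w p a)) (B.η-≡ w p a))
    }
    where module A = Agree A
          module B = Agree B
          open ≡-Reasoning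

  agree-weaken : ∀ {R R' k k'} → k' ≤ k → Agree R R' k → Agree R R' k'
  agree-weaken le A = record
    { obj-≡ = λ w p → A.obj-≡ w (<-≤-trans p le)
    ; map-≡ = λ f pw pv a → A.map-≡ f _ _ a
    ; η-≡   = λ w p a → A.η-≡ w _ a }
    where module A = Agree A

  module _ {R R' : Replacement} {k : ℕ} (A : Agree R R' k) where
    open Agree A
    private
      Y  = Replacement.Y R
      Y' = Replacement.Y R'

    -- Matching objects at z only involve objects of level < φ z, so
    -- replacements agreeing below k have isomorphic matching objects at
    -- every z of level ≤ k.
    matching-agree : (z : Obj) → φ₀ z ≤ k → Matching 𝓕 Y z ≅ₛ Matching 𝓕 Y' z
    matching-agree z hz = record
      { to      = forth
      ; from    = back
      ; from∘to = λ { (c , _) → Matching-≡ Y z (λ o → cast-coherent (e o) (sym (e o)) refl (c o)) }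
      ; to∘from = λ { (c , _) → Matching-≡ Y' z (λ o → cast-coherent (sym (e o)) (e o) refl (c o)) }
      }
      where
      open ≡-Reasoning
      below : (o : Category.Obj (C // z)) → φ₀ (proj₁ o) < k
      below (w , f , nid) = <-≤-trans (level-drops f nid) hz

      e : (o : Category.Obj (C // z)) → obj R (proj₁ o) ≡ obj R' (proj₁ o)
      e o = obj-≡ _ (below o)

      forth : Matching 𝓕 Y z → Matching 𝓕 Y' z
      forth (c , nat) = (λ o → cast (e o) (c o))
                      , λ {o} {o'} g → trans (sym (map-≡ (proj₁ g) (below o) (below o') (c o)))
                                             (cong (cast (e o')) (nat g))

      back : Matching 𝓕 Y' z → Matching 𝓕 Y z
      back (c , nat) = (λ o → cast (sym (e o)) (c o)) , λ {o} {o'} g → begin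
        map R (proj₁ g) (cast (sym (e o)) (c o))
          ≡⟨ sym (cast-coherent (e o') (sym (e o')) refl _) ⟩
        cast (sym (e o')) (cast (e o') (map R (proj₁ g) (cast (sym (e o)) (c o))))
          ≡⟨ cong (cast (sym (e o'))) (map-≡ (proj₁ g) (below o) (below o') _) ⟩
        cast (sym (e o')) (map R' (proj₁ g) (cast (e o) (cast (sym (e o)) (c o))))
          ≡⟨ cong (λ a → cast (sym (e o')) (map R' (proj₁ g) a)) (cast-coherent (sym (e o)) (e o) refl (c o)) ⟩
        cast (sym (e o')) (map R' (proj₁ g) (c o))
          ≡⟨ cong (cast (sym (e o'))) (nat g) ⟩
        cast (sym (e o')) (c o') ∎

    fibration-agree : (z : Obj) → φ₀ z < k
                      → IsFibration 𝓕 (matchingMap 𝓕 Y z) → IsFibration 𝓕 (matchingMap 𝓕 Y' z)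
    fibration-agree z hz =
      fibration-transfer (matchingMap 𝓕 Y z) (matchingMap 𝓕 Y' z) (cast-iso (obj-≡ z hz))
        (matching-agree z (<⇒≤ hz))
        (λ a → Matching-≡ Y' z (λ { (w , f , nid) → sym (map-≡ f hz _ a) }))

  module Step (R : Replacement) (n : ℕ)
              (matching-fibrant : ∀ w → φ₀ w ≡ n → Σ U (λ A → Matching 𝓕 (Replacement.Y R) w ≅ₛ El A))
              where
    open Extensional ext using (¬-irrelevant)
    private
      Y = Replacement.Y R
      module Y = Diagram Y

    factorisation : (w : Obj) (e : φ₀ w ≡ n) → Factorisation (matchingMap 𝓕 Y w)
    factorisation w e = factorise (proj₂ (matching-fibrant w e)) (matchingMap 𝓕 Y w)

    N : (w : Obj) → φ₀ w ≡ n → U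
    N w e = Factorisation.Mid (factorisation w e)

    inc : (w : Obj) (e : φ₀ w ≡ n) → El (Y.obj w) → El (N w e)
    inc w e = Factorisation.inc (factorisation w e)

    component : (w : Obj) (e : φ₀ w ≡ n) → El (N w e) → (v : Obj) (f : Hom w v) → NonIdentity C f
                → El (Y.obj v)
    component w e x v f nid = proj₁ (Factorisation.proj (factorisation w e) x) (v , f , nid)

    component-inc : ∀ w e b v f nid → component w e (inc w e b) v f nid ≡ Y.map f b
    component-inc w e b v f nid =
      cong (λ l → proj₁ l (v , f , nid)) (Factorisation.proj-inc (factorisation w e) b)

    component-natural : ∀ w e x {v u} (f : Hom w v) (g : Hom v u) nid nid'
                        → Y.map g (component w e x v f nid) ≡ component w e x u (g ∘ f) nid'
    component-natural w e x {v} f g nid nid' =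
      proj₂ (Factorisation.proj (factorisation w e) x) {v , f , nid} {_ , g ∘ f , nid'} (g , refl)

    component-irrelevant : ∀ w e x v {f f' : Hom w v} nid nid' → f ≡ f'
                           → component w e x v f nid ≡ component w e x v f' nid'
    component-irrelevant w e x v nid nid' refl = cong (component w e x v _) (¬-irrelevant nid nid')

    relevel : ∀ {w} {e e' : φ₀ w ≡ n} → e ≡ e' → El (N w e) → El (N w e')
    relevel {w} u = cast (cong (N w) u)

    relevel-coherent : ∀ {w} {e₁ e₂ e₃ : φ₀ w ≡ n} (u₁₂ : e₁ ≡ e₂) (u₂₃ : e₂ ≡ e₃) (u₁₃ : e₁ ≡ e₃) x
                       → relevel u₂₃ (relevel u₁₂ x) ≡ relevel u₁₃ x
    relevel-coherent refl refl refl x = refl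

    inc-relevel : ∀ {w} {e e' : φ₀ w ≡ n} (u : e ≡ e') b → inc w e' b ≡ relevel u (inc w e b)
    inc-relevel refl b = refl

    component-relevel : ∀ {w} {e e' : φ₀ w ≡ n} (u : e ≡ e') x v f nid
                        → component w e' (relevel u x) v f nid ≡ component w e x v f nid
    component-relevel refl x v f nid = refl

    -- An arrow between objects of level n is an identity, so the new objects
    -- at its ends are identified.
    identity-at-n : ∀ {w v} (f : Hom w v) → φ₀ w ≡ n → φ₀ v ≡ n → IsIdentity C f
    identity-at-n f e e' = creates f (trans e (sym e'))

    along : ∀ {w v} → w ≡ v → (e : φ₀ w ≡ n) (e' : φ₀ v ≡ n) → El (N w e) → El (N v e')
    along refl e e' = relevel (uip e e')

    along-loop : ∀ {w} (p : w ≡ w) (e : φ₀ w ≡ n) x → along p e e x ≡ x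
    along-loop refl e x = relevel-coherent (uip e e) refl refl x

    along-trans : ∀ {x y z} (p₁₃ : x ≡ z) (p₁₂ : x ≡ y) (p₂₃ : y ≡ z) e₁ e₂ e₃ a
                  → along p₁₃ e₁ e₃ a ≡ along p₂₃ e₂ e₃ (along p₁₂ e₁ e₂ a)
    along-trans refl refl refl e₁ e₂ e₃ a = sym (relevel-coherent (uip e₁ e₂) (uip e₂ e₃) (uip e₁ e₃) a)

    inc-along : ∀ {w v} {g : Hom w v} (I : IsIdentity C g) e e' b
                → inc v e' (Y.map g b) ≡ along (proj₁ I) e e' (inc w e b)
    inc-along {w} (refl , refl) e e' b = trans (cong (inc w e') (Y.map-id b)) (inc-relevel (uip e e') b)

    component-along : ∀ {x y z} {f : Hom x y} (I : IsIdentity C f) e e' a (g : Hom y z) nid nid'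
                      → component x e a z (g ∘ f) nid ≡ component y e' (along (proj₁ I) e e' a) z g nid'
    component-along {x} {z = z} (refl , refl) e e' a g nid nid' =
      trans (component-irrelevant x e a z nid nid' (idʳ g)) (sym (component-relevel (uip e e') a z g nid'))

    Level : Obj → Set
    Level w = Dec (φ₀ w ≡ n)

    level : (w : Obj) → Level w
    level w = φ₀ w ≟ n

    leaves-level : ∀ {w v} (f : Hom w v) → φ₀ w ≡ n → ¬ φ₀ v ≡ n → NonIdentity C f
    leaves-level f e ne = nonIdentity-of-≢ f (λ p → ne (trans (sym p) e))

    obj' : (w : Obj) → Level w → U
    obj' w (yes e) = N w e
    obj' w (no _)  = Y.obj w

    map' : ∀ {w v} (f : Hom w v) (lw : Level w) (lv : Level v) → El (obj' w lw) → El (obj' v lv)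
    map'         f (no _)  (no _)   = Y.map f
    map' {v = v} f (no _)  (yes e') = λ b → inc v e' (Y.map f b)
    map' {w} {v} f (yes e) (no ne)  = λ x → component w e x v f (leaves-level f e ne)
    map'         f (yes e) (yes e') = along (proj₁ (identity-at-n f e e')) e e'

    η' : (w : Obj) (lw : Level w) → El (X.obj w) → El (obj' w lw)
    η' w (no _)  = η R w
    η' w (yes e) = λ a → inc w e (η R w a)

    map'-id : ∀ {w} (lw : Level w) a → map' id lw lw a ≡ a
    map'-id (no _)  a = Y.map-id a
    map'-id (yes e) a = along-loop (proj₁ (identity-at-n id e e)) e a

    squeezed : ∀ {x y z} (f : Hom x y) (g : Hom y z) → φ₀ x ≡ n → φ₀ z ≡ n → φ₀ y ≡ n
    squeezed {y = y} f g e e' = ≤-antisym (subst (φ₀ y ≤_) e (φ₁ f)) (subst (_≤ φ₀ y) e' (φ₁ g))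

    map'-∘ : ∀ {x y z} (g : Hom y z) (f : Hom x y) (lx : Level x) (ly : Level y) (lz : Level z) a
             → map' (g ∘ f) lx lz a ≡ map' g ly lz (map' f lx ly a)
    map'-∘         g f (no _)  (no _)   (no _)   a = Y.map-∘ g f a
    map'-∘ {z = z} g f (no _)  (no _)   (yes e)  a = cong (inc z e) (Y.map-∘ g f a)
    map'-∘ {y = y} g f (no _)  (yes e)  (no _)   a =
      trans (Y.map-∘ g f a) (sym (component-inc y e (Y.map f a) _ g _))
    map'-∘ {z = z} g f (no _)  (yes e)  (yes e') a =
      trans (cong (inc z e') (Y.map-∘ g f a)) (inc-along (identity-at-n g e e') e e' (Y.map f a))
    map'-∘ {x}     g f (yes e) (no _)   (no _)   a = sym (component-natural x e a f g _ _)
    map'-∘         g f (yes e) (no ne)  (yes e') a = ⊥-elim (ne (squeezed f g e e'))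
    map'-∘         g f (yes e) (yes e') (no _)   a = component-along (identity-at-n f e e') e e' a g _ _
    map'-∘         g f (yes e₁) (yes e₂) (yes e₃) a =
      along-trans (at-n (g ∘ f) e₁ e₃) (at-n f e₁ e₂) (at-n g e₂ e₃) e₁ e₂ e₃ a
      where at-n = λ {w v} (h : Hom w v) e e' → proj₁ (identity-at-n h e e')

    η'-natural : ∀ {w v} (f : Hom w v) (lw : Level w) (lv : Level v) a
                 → η' v lv (X.map f a) ≡ map' f lw lv (η' w lw a)
    η'-natural         f (no _)  (no _)   a = natural R f a
    η'-natural {v = v} f (no _)  (yes e') a = cong (inc v e') (natural R f a)
    η'-natural {w}     f (yes e) (no _)   a =
      trans (natural R f a) (sym (component-inc w e (η R w a) _ f _))
    η'-natural {w} {v} f (yes e) (yes e') a =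
      trans (cong (inc v e') (natural R f a)) (inc-along (identity-at-n f e e') e e' (η R w a))

    next : Replacement
    next = record
      { Y = record
          { obj    = λ w → obj' w (level w)
          ; map    = λ {w} {v} f → map' f (level w) (level v)
          ; map-id = λ {w} → map'-id (level w)
          ; map-∘  = λ {x} {y} {z} g f → map'-∘ g f (level x) (level y) (level z) }
      ; η = record
          { η       = λ w → η' w (level w)
          ; natural = λ {w} {v} f → η'-natural f (level w) (level v) }
      }

    private
      unchanged : ∀ w → φ₀ w < n → (lw : Level w) → Y.obj w ≡ obj' w lw
      unchanged w p (no _)  = refl
      unchanged w p (yes e) = ⊥-elim (<-irrefl e p)

      unchanged-map : ∀ {w v} (f : Hom w v) pw pv (lw : Level w) (lv : Level v) a
                      → cast (unchanged v pv lv) (Y.map f a) ≡ map' f lw lv (cast (unchanged w pw lw) a)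
      unchanged-map f pw pv (no _)  (no _)  a = refl
      unchanged-map f pw pv (yes e) _       a = ⊥-elim (<-irrefl e pw)
      unchanged-map f pw pv (no _)  (yes e) a = ⊥-elim (<-irrefl e pv)

      unchanged-η : ∀ w p (lw : Level w) a → cast (unchanged w p lw) (η R w a) ≡ η' w lw a
      unchanged-η w p (no _)  a = refl
      unchanged-η w p (yes e) a = ⊥-elim (<-irrefl e p)

    next-agrees : Agree R next n
    next-agrees = record
      { obj-≡ = λ w p → unchanged w p (level w)
      ; map-≡ = λ {w} {v} f pw pv → unchanged-map f pw pv (level w) (level v)
      ; η-≡   = λ w p → unchanged-η w p (level w) }

    -- η stays an equivalence: at level n it is composed with the equivalence
    -- of the factorisation.
    next-equiv : (∀ w → IsEquiv 𝓕 {X.obj w} {obj R w} (η R w))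
                 → ∀ w → IsEquiv 𝓕 {X.obj w} {obj next w} (η next w)
    next-equiv equiv w = go (level w)
      where
      go : (lw : Level w) → IsEquiv 𝓕 {X.obj w} {obj' w lw} (η' w lw)
      go (no _)  = equiv w
      go (yes e) = equiv-∘ (Factorisation.inc-equiv (factorisation w e)) (equiv w)

    -- At an object of level n the new matching map is, up to isomorphism,
    -- the fibration of the factorisation.
    new-fibrant : ∀ w → φ₀ w ≡ n → IsFibration 𝓕 (matchingMap 𝓕 (Replacement.Y next) w)
    new-fibrant w e =
      fibration-transfer (Factorisation.proj (factorisation w e)) (matchingMap 𝓕 Y' w)
        (cast-iso (new-obj (level w))) (matching-agree next-agrees w (≤-reflexive e))
        (λ x → Matching-≡ Y' w (λ { (v , f , nid) → square x v f nid (level w) (level v) _ }))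
        (Factorisation.proj-fibration (factorisation w e))
      where
      Y' = Replacement.Y next

      new-obj : (lw : Level w) → N w e ≡ obj' w lw
      new-obj (yes e') = cong (N w) (uip e e')
      new-obj (no ne)  = ⊥-elim (ne e)

      square : ∀ x v f nid (lw : Level w) (lv : Level v) (pv : φ₀ v < n)
               → map' f lw lv (cast (new-obj lw) x) ≡ cast (unchanged v pv lv) (component w e x v f nid)
      square x v f nid (yes e') (no _)   pv =
        trans (component-relevel (uip e e') x v f _) (component-irrelevant w e x v _ nid refl)
      square x v f nid (yes _)  (yes e') pv = ⊥-elim (<-irrefl e' pv)
      square x v f nid (no ne)  _        pv = ⊥-elim (ne e)

    next-fibrant : (∀ w → φ₀ w < n → IsFibration 𝓕 (matchingMap 𝓕 Y w))
                   → ∀ w → φ₀ w < suc n → IsFibration 𝓕 (matchingMap 𝓕 (Replacement.Y next) w)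
    next-fibrant fib w p with m<1+n⇒m<n∨m≡n p
    ... | inj₁ q = fibration-agree next-agrees w q (fib w q)
    ... | inj₂ e = new-fibrant w e

  record Stage (n : ℕ) : Set where
    field
      replacement   : Replacement
      equiv         : ∀ w → IsEquiv 𝓕 {X.obj w} {obj replacement w} (η replacement w)
      fibrant-below : ∀ w → φ₀ w < n → IsFibration 𝓕 (matchingMap 𝓕 (Replacement.Y replacement) w)

  module Construction (adm : Admissible 𝓕 C inv) where

    matching-fibrant : (R : Replacement) (n : ℕ)
                       → (∀ w → φ₀ w < n → IsFibration 𝓕 (matchingMap 𝓕 (Replacement.Y R) w))
                       → ∀ w → φ₀ w ≡ n → Σ U (λ A → Matching 𝓕 (Replacement.Y R) w ≅ₛ El A)
    matching-fibrant R n fib w e =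
      adm w (restrict Y w) (restrict-reedy Y w (λ v p → fib v (subst (φ₀ v <_) e p)))
      where Y = Replacement.Y R

    module StepAt (n : ℕ) (s : Stage n) =
      Step (Stage.replacement s) n (matching-fibrant (Stage.replacement s) n (Stage.fibrant-below s))

    stage : ∀ n → Stage n
    stage zero    = record
      { replacement   = record { Y = X ; η = record { η = λ _ a → a ; natural = λ _ _ → refl } }
      ; equiv         = λ _ → equiv-id
      ; fibrant-below = λ _ () }
    stage (suc n) = record
      { replacement   = next
      ; equiv         = next-equiv (Stage.equiv (stage n))
      ; fibrant-below = next-fibrant (Stage.fibrant-below (stage n)) }
      where open StepAt n (stage n)

    stageR : ℕ → Replacement
    stageR n = Stage.replacement (stage n)

    stage-agree : ∀ {k m} → k ≤′ m → Agree (stageR k) (stageR m) k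
    stage-agree (≤′-reflexive refl) = agree-refl
    stage-agree {m = suc m} (≤′-step le) =
      agree-trans (stage-agree le) (agree-weaken (≤′⇒≤ le) (StepAt.next-agrees m (stage m)))

    -- The object w is settled from stage φ w + 1 on; the limit takes its
    -- value there.
    settling : Obj → Replacement
    settling w = stageR (suc (φ₀ w))

    own-level : ∀ w → φ₀ w < suc (φ₀ w)
    own-level w = n<1+n (φ₀ w)

    settled : ∀ {z w} → φ₀ w < suc (φ₀ z) → Agree (settling w) (settling z) (suc (φ₀ w))
    settled p = stage-agree (≤⇒≤′ p)

    settled-obj : ∀ {z w} (p : φ₀ w < suc (φ₀ z)) → obj (settling z) w ≡ obj (settling w) w
    settled-obj {w = w} p = sym (Agree.obj-≡ (settled p) w (own-level w))

    limit-map : ∀ {z w} (f : Hom z w) → El (obj (settling z) z) → El (obj (settling w) w)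
    limit-map {z} f a = cast (settled-obj (s≤s (φ₁ f))) (map (settling z) f a)

    limit-map-∘ : ∀ {x y z} (g : Hom y z) (f : Hom x y) a
                  → limit-map (g ∘ f) a ≡ limit-map g (limit-map f a)
    limit-map-∘ {x} {y} {z} g f a = begin
      cast E₁ (map Sx (g ∘ f) a)
        ≡⟨ cong (cast E₁) (Diagram.map-∘ (Replacement.Y Sx) g f a) ⟩
      cast E₁ (map Sx g b)
        ≡⟨ cong (cast E₁ ∘′ map Sx g) (sym (cast-coherent Ef (A.obj-≡ y (own-level y)) refl b)) ⟩
      cast E₁ (map Sx g (cast (A.obj-≡ y (own-level y)) (cast Ef b)))
        ≡⟨ cong (cast E₁) (sym (A.map-≡ g (own-level y) (s≤s (φ₁ g)) (cast Ef b))) ⟩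
      cast E₁ (cast (A.obj-≡ z (s≤s (φ₁ g))) (map Sy g (cast Ef b)))
        ≡⟨ cast-coherent (A.obj-≡ z (s≤s (φ₁ g))) E₁ _ _ ⟩
      limit-map g (limit-map f a) ∎
      where
      open ≡-Reasoning
      Sx = settling x
      Sy = settling y
      module A = Agree (settled {x} {y} (s≤s (φ₁ f)))
      E₁ = settled-obj (s≤s (φ₁ (g ∘ f)))
      Ef = settled-obj (s≤s (φ₁ f))
      b  = map Sx f a

    limit-natural : ∀ {z w} (f : Hom z w) a
                    → η (settling w) w (X.map f a) ≡ limit-map f (η (settling z) z a)
    limit-natural {z} {w} f a = sym (begin
      cast E (map (settling z) f (η (settling z) z a))
        ≡⟨ cong (cast E) (sym (natural (settling z) f a)) ⟩
      cast E (η (settling z) w (X.map f a))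
        ≡⟨ cong (cast E) (sym (A.η-≡ w (own-level w) (X.map f a))) ⟩
      cast E (cast (A.obj-≡ w (own-level w)) (η (settling w) w (X.map f a)))
        ≡⟨ cast-coherent (A.obj-≡ w (own-level w)) E refl _ ⟩
      η (settling w) w (X.map f a) ∎)
      where
      open ≡-Reasoning
      module A = Agree (settled {z} {w} (s≤s (φ₁ f)))
      E = settled-obj (s≤s (φ₁ f))

    limit : Replacement
    limit = record
      { Y = record
          { obj    = λ w → obj (settling w) w
          ; map    = limit-map
          ; map-id = λ {z} a → trans (cast-coherent (settled-obj (s≤s (φ₁ (id {z})))) refl refl _)
                                     (Diagram.map-id (Replacement.Y (settling z)) a)
          ; map-∘  = limit-map-∘ }
      ; η = record { η = λ w → η (settling w) w ; natural = limit-natural }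
      }

    limit-agrees : ∀ z → Agree (settling z) limit (suc (φ₀ z))
    limit-agrees z = record
      { obj-≡ = λ w p → settled-obj p
      ; map-≡ = λ {w} {v} f pw pv a → map-agrees f pw pv a
      ; η-≡   = λ w p a → trans (cong (cast (settled-obj p)) (sym (Agree.η-≡ (settled p) w (own-level w) a)))
                                (cast-coherent (Agree.obj-≡ (settled p) w (own-level w)) (settled-obj p) refl _)
      }
      where
      map-agrees : ∀ {w v} (f : Hom w v) (pw : φ₀ w < suc (φ₀ z)) (pv : φ₀ v < suc (φ₀ z)) a
                   → cast (settled-obj pv) (map (settling z) f a) ≡ limit-map f (cast (settled-obj pw) a)
      map-agrees {w} {v} f pw pv a = begin
        cast (settled-obj pv) (map (settling z) f a)
          ≡⟨ cong (cast (settled-obj pv) ∘′ map (settling z) f)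
                  (sym (cast-coherent (settled-obj pw) (B.obj-≡ w (own-level w)) refl a)) ⟩
        cast (settled-obj pv) (map (settling z) f (cast (B.obj-≡ w (own-level w)) a'))
          ≡⟨ cong (cast (settled-obj pv)) (sym (B.map-≡ f (own-level w) (s≤s (φ₁ f)) a')) ⟩
        cast (settled-obj pv) (cast (B.obj-≡ v (s≤s (φ₁ f))) (map (settling w) f a'))
          ≡⟨ cast-coherent (B.obj-≡ v (s≤s (φ₁ f))) (settled-obj pv) _ _ ⟩
        limit-map f a' ∎
        where
        open ≡-Reasoning
        module B = Agree (settled {z} {w} pw)
        a' = cast (settled-obj pw) a

    -- The limit is Reedy fibrant, and η is an equivalence, because at z it
    -- agrees with the stage settling z, which has both properties there.
    reedy : ReedyFibrant 𝓕 (Replacement.Y limit)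
    reedy z = fibration-agree (limit-agrees z) z (own-level z)
                (Stage.fibrant-below (stage (suc (φ₀ z))) z (own-level z))

    equivalence : IsEquivalence 𝓕 (Replacement.η limit)
    equivalence w = Stage.equiv (stage (suc (φ₀ w))) w

mainTheorem5 : (𝓕 : FibrantUniverse) → Extensionality 0ℓ 0ℓ
    → (C : Category) (inv : IsInverse C) → Admissible 𝓕 C inv
    → (X : Diagram 𝓕 C)
    → Σ (Diagram 𝓕 C) (λ Y → ReedyFibrant 𝓕 Y
    × Σ (NatTrans 𝓕 X Y) (λ η → IsEquivalence 𝓕 η))
mainTheorem5 𝓕 ext C inv adm X =
  Replacement.Y limit , reedy , Replacement.η limit , equivalence
  where
  open Replacements 𝓕 ext C inv X
  open Construction adm
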